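{- Let $M$ be a matroid on ground set $S$ with a standard coloring, and let $Z\subseteq S$ be such that exactly $r_M(Z)$ colors appear in $Z$. Then the coloring restricted to $Z$ (with color classes the nonempty sets $Z\cap S_i$) is a standard coloring of $M|Z$.
   Context: A cut of a matroid is an inclusionwise minimal subset of the ground set meeting every basis. For a matroid $N$ of rank $r$ on ground set $T$, a standard coloring is a partition of $T$ into $r$ color classes that can be indexed $S_1,\dots,S_r$ so that for every $i$, $S_i$ is a cut of the restriction $N|(S_1\cup\dots\cup S_i)$. -}

module Defs where

open import Data.Nat using (ℕ; _<_; _≤_; _≤?_)
open import Data.Fin using (Fin; toℕ; _≟_)
open import Data.Fin.Properties using (any?)
open import Data.Fin.Subset using (Subset; _∈_; _∉_; _⊆_; _∪_; ⁅_⁆; ⊥; ∣_∣)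
open import Data.Fin.Subset.Properties using (_∈?_)
open import Data.Bool using (_∧_)
open import Data.Vec using (tabulate)
open import Data.Product using (Σ; ∃; _×_; _,_)
open import Relation.Nullary using (Dec; ¬_)
open import Relation.Nullary.Decidable using (⌊_⌋; _×-dec_)
open import Relation.Binary.PropositionalEquality using (_≡_)
open import Function.Definitions using (Injective)
open import Function.Bundles using (_⇔_)

-- A (finite) matroid on the ground set Fin n, given by its independent sets.
-- Independence is assumed decidable (harmless for finite matroids).
record Matroid (n : ℕ) : Set₁ where
  field
    Indep       : Subset n → Set
    Indep?      : (I : Subset n) → Dec (Indep I)
    indep-empty : Indep ⊥
    indep-sub   : ∀ {I J} → J ⊆ I → Indep I → Indep J
    indep-aug   : ∀ {I J} → Indep I → Indep J → ∣ I ∣ < ∣ J ∣ →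
                  ∃ λ x → x ∈ J × x ∉ I × Indep (I ∪ ⁅ x ⁆)
open Matroid public

module _ {n : ℕ} (M : Matroid n) where

  IsBasis : Subset n → Subset n → Set
  IsBasis X B = B ⊆ X × Indep M B ×
    (∀ J → J ⊆ X → Indep M J → B ⊆ J → J ⊆ B)

  IsRank : Subset n → ℕ → Set
  IsRank X k = (∃ λ I → I ⊆ X × Indep M I × ∣ I ∣ ≡ k) ×
    (∀ I → I ⊆ X → Indep M I → ∣ I ∣ ≤ k)

  Meets : Subset n → Subset n → Set
  Meets C B = ∃ λ x → x ∈ C × x ∈ B

  MeetsAllBases : Subset n → Subset n → Set
  MeetsAllBases X C = ∀ B → IsBasis X B → Meets C B

  IsCut : Subset n → Subset n → Set
  IsCut X C = C ⊆ X × MeetsAllBases X C ×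
    (∀ D → D ⊆ C → MeetsAllBases X D → C ⊆ D)

module _ {n m : ℕ} (col : Fin n → Fin m) where

  Class : Subset n → Fin m → Subset n
  Class X c = tabulate λ x → ⌊ x ∈? X ⌋ ∧ ⌊ col x ≟ c ⌋

  Appears : Subset n → Fin m → Set
  Appears X c = ∃ λ x → x ∈ X × col x ≡ c

  Enumerates : Subset n → (k : ℕ) → (Fin k → Fin m) → Set
  Enumerates X k σ = Injective _≡_ _≡_ σ × (∀ c → Appears X c ⇔ (∃ λ i → σ i ≡ c))

  NumColors : Subset n → ℕ → Set
  NumColors X k = Σ (Fin k → Fin m) (Enumerates X k)

  -- S_{σ 0} ∪ ... ∪ S_{σ i}, all classes taken inside X.
  Prefix : Subset n → {k : ℕ} → (Fin k → Fin m) → Fin k → Subset n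
  Prefix X σ i = tabulate λ x → ⌊ x ∈? X ⌋ ∧
    ⌊ any? (λ j → (toℕ j ≤? toℕ i) ×-dec (σ j ≟ col x)) ⌋

  -- The coloring col restricted to X (color classes: the nonempty sets X ∩ col⁻¹(c))
  -- is a standard coloring of M|X : the number of classes is r_M(X), and the classes
  -- can be indexed S_1,...,S_r (via σ) so that each S_i is a cut of M|(S_1 ∪ ... ∪ S_i).
  IsStandardColoring : Matroid n → Subset n → Set
  IsStandardColoring M X = ∃ λ k → IsRank M X k × Σ (Fin k → Fin m) λ σ →
    Enumerates X k σ × (∀ i → IsCut M (Prefix X σ i) (Class X (σ i)))

-- Write S_q for the classes of the standard coloring and P_q = S_1 ∪ … ∪ S_q. Because S_q is
-- a cut of M|P_q, no element e of S_q lies in the closure of P_q ∖ S_q: otherwise S_q ∖ {e}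
-- would still meet every basis of M|P_q. List the colors appearing in Z in the order of the
-- coloring. Each new color then raises the rank of Z ∩ P_q strictly, and since there are
-- exactly r_M(Z) such colors, it raises it by exactly one. Hence Z ∩ (P_q ∖ S_q) is a
-- hyperplane of M|(Z ∩ P_q) whose complement Z ∩ S_q avoids its closure, and the complement
-- of such a hyperplane is a cut.
module Submission where

open import Defs
open import Data.Bool using (_∧_)
open import Data.Bool.Properties using (T-≡; T-∧)
open import Data.Empty using (⊥-elim)
open import Data.Fin using (Fin; zero; suc; toℕ; fromℕ<; _≟_)
open import Data.Fin.Properties using (any?; suc-injective; toℕ<n; toℕ-fromℕ<; injective⇒≤)
open import Data.Fin.Subset
  using (Subset; outside; ⊤; ⊥; _∈_; _∉_; _⊆_; _∪_; ⁅_⁆; _─_; _-_; ∣_∣)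
open import Data.Fin.Subset.Properties
  using (_∈?_; ∈⊤; ⊥⊆; p⊆p∪q; x∈p∪q⁺; x∈p∪q⁻; x∈⁅x⁆; x∈⁅y⁆⇒x≡y; ∣p∣≤n; p⊂q⇒∣p∣<∣q∣;
         x∈p∧x∉q⇒x∈p─q; p─q⊆p; x∈p∧x≢y⇒x∈p-y)
open import Data.Nat using (ℕ; zero; suc; _+_; _∸_; _≤_; _<_; _≤?_; _<?_; z≤n; s≤s)
open import Data.Nat.Properties
  using (≤-refl; ≤-trans; ≤-antisym; ≤-reflexive; <-irrefl; <⇒≤; <⇒≱; ≰⇒>; ≤-<-trans; <-≤-trans;
         m≤m+n; m≤n+m; +-suc; +-identityʳ; +-monoˡ-≤; +-monoʳ-≤; +-cancelʳ-≤; m+[n∸m]≡n;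
         module ≤-Reasoning)
open import Data.Product using (Σ; ∃; _×_; _,_; proj₁; proj₂)
open import Data.Sum using (_⊎_; inj₁; inj₂)
open import Data.Vec using (_∷_; here; there; tabulate)
open import Data.Vec.Properties using (lookup∘tabulate; lookup⇒[]=; []=⇒lookup)
open import Function using (_∘_; id)
open import Function.Bundles using (Equivalence; mk⇔)
open import Function.Definitions using (Injective)
open import Relation.Binary.PropositionalEquality using (_≡_; refl; sym; trans; cong; subst)
open import Relation.Nullary using (yes; no; ¬_; ¬?; contradiction)
open import Relation.Nullary.Decidable using (⌊_⌋; _×-dec_; toWitness; fromWitness)
open import Relation.Unary using (Decidable)

module _ {n : ℕ} {A B : Fin n → Set} (A? : Decidable A) (B? : Decidable B) where

  ∈tabulate-∧⁺ : ∀ {x} → A x → B x → x ∈ tabulate (λ y → ⌊ A? y ⌋ ∧ ⌊ B? y ⌋)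
  ∈tabulate-∧⁺ {x} a b = lookup⇒[]= x _ (trans (lookup∘tabulate _ x)
    (Equivalence.to T-≡ (Equivalence.from (T-∧ {⌊ A? x ⌋} {⌊ B? x ⌋})
      (fromWitness {a? = A? x} a , fromWitness {a? = B? x} b))))

  ∈tabulate-∧⁻ : ∀ {x} → x ∈ tabulate (λ y → ⌊ A? y ⌋ ∧ ⌊ B? y ⌋) → A x × B x
  ∈tabulate-∧⁻ {x} x∈ with Equivalence.to T-∧
      (Equivalence.from T-≡ (trans (sym (lookup∘tabulate _ x)) ([]=⇒lookup x∈)))
  ... | a , b = toWitness {a? = A? x} a , toWitness {a? = B? x} b

x∈p─q⇒x∉q : ∀ {n} {p q : Subset n} {x} → x ∈ p ─ q → x ∉ q
x∈p─q⇒x∉q {p = _ ∷ _} {outside ∷ _} here ()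
x∈p─q⇒x∉q {p = _ ∷ _} {_ ∷ _} (there x∈) (there x∈q) = x∈p─q⇒x∉q x∈ x∈q

module _ {n : ℕ} where

  x∈p∪⁅x⁆ : ∀ {p : Subset n} {x} → x ∈ p ∪ ⁅ x ⁆
  x∈p∪⁅x⁆ {x = x} = x∈p∪q⁺ (inj₂ (x∈⁅x⁆ x))

  y∈p∪⁅x⁆⇒y∈p⊎y≡x : ∀ (p : Subset n) {x y} → y ∈ p ∪ ⁅ x ⁆ → y ∈ p ⊎ y ≡ x
  y∈p∪⁅x⁆⇒y∈p⊎y≡x p {x} y∈ with x∈p∪q⁻ p ⁅ x ⁆ y∈
  ... | inj₁ y∈p = inj₁ y∈p
  ... | inj₂ y∈⁅x⁆ = inj₂ (x∈⁅y⁆⇒x≡y x y∈⁅x⁆)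

  p⊆q∧x∈q⇒p∪⁅x⁆⊆q : ∀ {p q : Subset n} {x} → p ⊆ q → x ∈ q → p ∪ ⁅ x ⁆ ⊆ q
  p⊆q∧x∈q⇒p∪⁅x⁆⊆q {p} p⊆q x∈q y∈ with y∈p∪⁅x⁆⇒y∈p⊎y≡x p y∈
  ... | inj₁ y∈p = p⊆q y∈p
  ... | inj₂ refl = x∈q

  x∉p⇒∣p∣<∣p∪⁅x⁆∣ : ∀ (p : Subset n) {x} → x ∉ p → ∣ p ∣ < ∣ p ∪ ⁅ x ⁆ ∣
  x∉p⇒∣p∣<∣p∪⁅x⁆∣ p {x} x∉p = p⊂q⇒∣p∣<∣q∣ (p⊆p∪q ⁅ x ⁆ , x , x∈p∪⁅x⁆ , x∉p)

module _ (g : ℕ → ℕ) {len : ℕ} (increasing : ∀ t → t < len → suc (g t) ≤ g (suc t)) where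
  open ≤-Reasoning

  increasing⇒+-≤ : ∀ d t → t + d ≤ len → g t + d ≤ g (t + d)
  increasing⇒+-≤ zero t _ = ≤-reflexive (trans (+-identityʳ (g t)) (cong g (sym (+-identityʳ t))))
  increasing⇒+-≤ (suc d) t t+d+1≤len = begin
    g t + suc d    ≡⟨ +-suc (g t) d ⟩
    suc (g t) + d  ≤⟨ +-monoˡ-≤ d (increasing t (≤-trans (s≤s (m≤m+n t d)) t+1+d≤len)) ⟩
    g (suc t) + d  ≤⟨ increasing⇒+-≤ d (suc t) t+1+d≤len ⟩
    g (suc t + d)  ≡⟨ cong g (sym (+-suc t d)) ⟩
    g (t + suc d)  ∎
    where
    t+1+d≤len : suc t + d ≤ len
    t+1+d≤len = subst (_≤ len) (+-suc t d) t+d+1≤len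

  steps≤1 : g len ≤ len → ∀ t → t < len → g (suc t) ≤ suc (g t)
  steps≤1 bounded t t<len = +-cancelʳ-≤ d (g (suc t)) (suc (g t)) (begin
    g (suc t) + d  ≤⟨ increasing⇒+-≤ d (suc t) (≤-reflexive t+1+d≡len) ⟩
    g (suc t + d)  ≡⟨ cong g t+1+d≡len ⟩
    g len          ≤⟨ bounded ⟩
    len            ≡⟨ sym t+1+d≡len ⟩
    suc t + d      ≤⟨ +-monoˡ-≤ d (s≤s (≤-trans (m≤n+m t (g 0)) (increasing⇒+-≤ t 0 (<⇒≤ t<len)))) ⟩
    suc (g t) + d  ∎)
    where
    d = len ∸ suc t

    t+1+d≡len : suc t + d ≡ len
    t+1+d≡len = m+[n∸m]≡n t<len

record IncreasingEnumeration {N : ℕ} (P : Fin N → Set) : Set where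
  field
    size           : ℕ
    pick           : Fin size → Fin N
    pick-sat       : ∀ i → P (pick i)
    pick-onto      : ∀ {q} → P q → ∃ λ i → pick i ≡ q
    pick-injective : Injective _≡_ _≡_ pick
    pick-monotone  : ∀ {i j} → toℕ i ≤ toℕ j → toℕ (pick i) ≤ toℕ (pick j)

module _ {N : ℕ} {P : Fin (suc N) → Set} (E : IncreasingEnumeration (P ∘ suc)) where
  open IncreasingEnumeration E

  skipZero : ¬ P zero → IncreasingEnumeration P
  skipZero ¬p = record
    { size = size ; pick = suc ∘ pick ; pick-sat = pick-sat ; pick-onto = onto
    ; pick-injective = pick-injective ∘ suc-injective ; pick-monotone = s≤s ∘ pick-monotone }
    where
    onto : ∀ {q} → P q → ∃ λ i → suc (pick i) ≡ q
    onto {zero} p = contradiction p ¬p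
    onto {suc q} p = let i , pick-i≡q = pick-onto p in i , cong suc pick-i≡q

  keepZero : P zero → IncreasingEnumeration P
  keepZero p₀ = record
    { size = suc size ; pick = pick′ ; pick-sat = sat ; pick-onto = onto
    ; pick-injective = injective ; pick-monotone = monotone }
    where
    pick′ : Fin (suc size) → Fin (suc N)
    pick′ zero = zero
    pick′ (suc i) = suc (pick i)

    sat : ∀ i → P (pick′ i)
    sat zero = p₀
    sat (suc i) = pick-sat i

    onto : ∀ {q} → P q → ∃ λ i → pick′ i ≡ q
    onto {zero} _ = zero , refl
    onto {suc q} p = let i , pick-i≡q = pick-onto p in suc i , cong suc pick-i≡q

    injective : Injective _≡_ _≡_ pick′
    injective {zero} {zero} _ = refl
    injective {suc i} {suc j} eq = cong suc (pick-injective (suc-injective eq))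

    monotone : ∀ {i j} → toℕ i ≤ toℕ j → toℕ (pick′ i) ≤ toℕ (pick′ j)
    monotone {zero} _ = z≤n
    monotone {suc i} {suc j} (s≤s i≤j) = s≤s (pick-monotone i≤j)

increasingEnumeration : ∀ {N} {P : Fin N → Set} → Decidable P → IncreasingEnumeration P
increasingEnumeration {zero} _ = record
  { size = 0 ; pick = λ () ; pick-sat = λ () ; pick-onto = λ { {()} }
  ; pick-injective = λ { {()} } ; pick-monotone = λ { {()} } }
increasingEnumeration {suc N} P? with P? zero
... | yes p = keepZero (increasingEnumeration (P? ∘ suc)) p
... | no ¬p = skipZero (increasingEnumeration (P? ∘ suc)) ¬p

module MatroidTheory {n : ℕ} (M : Matroid n) where

  _∉-cl_ : Fin n → Subset n → Set
  e ∉-cl Y = ∀ I → I ⊆ Y → Indep M I → Indep M (I ∪ ⁅ e ⁆)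

  ∉-cl-antitone : ∀ {Y Y′ e} → Y′ ⊆ Y → e ∉-cl Y → e ∉-cl Y′
  ∉-cl-antitone Y′⊆Y e∉clY I I⊆Y′ = e∉clY I (Y′⊆Y ∘ I⊆Y′)

  private
    extend : ∀ fuel X I → n ≤ fuel + ∣ I ∣ → I ⊆ X → Indep M I →
             ∃ λ B → I ⊆ B × IsBasis M X B
    extend fuel X I n≤ I⊆X indI
      with any? (λ x → (x ∈? X) ×-dec ¬? (x ∈? I) ×-dec Indep? M (I ∪ ⁅ x ⁆))
    ... | no ¬augmentable = I , id , I⊆X , indI , maximal
      where
      maximal : ∀ J → J ⊆ X → Indep M J → I ⊆ J → J ⊆ I
      maximal J J⊆X indJ I⊆J {y} y∈J with y ∈? I
      ... | yes y∈I = y∈I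
      ... | no y∉I = ⊥-elim (¬augmentable
              (y , J⊆X y∈J , y∉I , indep-sub M (p⊆q∧x∈q⇒p∪⁅x⁆⊆q I⊆J y∈J) indJ))
    extend zero X I n≤ _ _ | yes (x , _ , x∉I , _) =
      ⊥-elim (<-irrefl refl (≤-<-trans n≤ (<-≤-trans (x∉p⇒∣p∣<∣p∪⁅x⁆∣ I x∉I) (∣p∣≤n (I ∪ ⁅ x ⁆)))))
    extend (suc fuel) X I n≤ I⊆X _ | yes (x , x∈X , x∉I , indIx)
      with extend fuel X (I ∪ ⁅ x ⁆) n≤′ (p⊆q∧x∈q⇒p∪⁅x⁆⊆q I⊆X x∈X) indIx
      where
      n≤′ : n ≤ fuel + ∣ I ∪ ⁅ x ⁆ ∣
      n≤′ = ≤-trans n≤ (≤-trans (≤-reflexive (sym (+-suc fuel ∣ I ∣)))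
                                (+-monoʳ-≤ fuel (x∉p⇒∣p∣<∣p∪⁅x⁆∣ I x∉I)))
    ... | B , I∪x⊆B , B-basis = B , I∪x⊆B ∘ p⊆p∪q ⁅ x ⁆ , B-basis

  extendToBasis : ∀ X I → I ⊆ X → Indep M I → ∃ λ B → I ⊆ B × IsBasis M X B
  extendToBasis X I = extend n X I (m≤m+n n ∣ I ∣)

  basis : Subset n → Subset n
  basis X = proj₁ (extendToBasis X ⊥ ⊥⊆ (indep-empty M))

  basis-isBasis : ∀ X → IsBasis M X (basis X)
  basis-isBasis X = proj₂ (proj₂ (extendToBasis X ⊥ ⊥⊆ (indep-empty M)))

  basis⊆ : ∀ X → basis X ⊆ X
  basis⊆ X = proj₁ (basis-isBasis X)

  basis-indep : ∀ X → Indep M (basis X)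
  basis-indep X = proj₁ (proj₂ (basis-isBasis X))

  rk : Subset n → ℕ
  rk X = ∣ basis X ∣

  basis-maximum : ∀ {X B J} → IsBasis M X B → J ⊆ X → Indep M J → ∣ J ∣ ≤ ∣ B ∣
  basis-maximum {B = B} {J} (B⊆X , indB , maximal) J⊆X indJ with ∣ J ∣ ≤? ∣ B ∣
  ... | yes ∣J∣≤∣B∣ = ∣J∣≤∣B∣
  ... | no ∣J∣≰∣B∣ with indep-aug M indB indJ (≰⇒> ∣J∣≰∣B∣)
  ... | x , x∈J , x∉B , indBx =
    ⊥-elim (x∉B (maximal _ (p⊆q∧x∈q⇒p∪⁅x⁆⊆q B⊆X (J⊆X x∈J)) indBx (p⊆p∪q ⁅ x ⁆) x∈p∪⁅x⁆))

  rk-bound : ∀ {X J} → J ⊆ X → Indep M J → ∣ J ∣ ≤ rk X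
  rk-bound {X} = basis-maximum (basis-isBasis X)

  basis-size : ∀ {X B} → IsBasis M X B → ∣ B ∣ ≡ rk X
  basis-size {X} B-basis@(B⊆X , indB , _) =
    ≤-antisym (rk-bound B⊆X indB) (basis-maximum B-basis (basis⊆ X) (basis-indep X))

  rk≤⇒basis : ∀ {X B} → B ⊆ X → Indep M B → rk X ≤ ∣ B ∣ → IsBasis M X B
  rk≤⇒basis {X} {B} B⊆X indB rk≤∣B∣ = B⊆X , indB , maximal
    where
    maximal : ∀ J → J ⊆ X → Indep M J → B ⊆ J → J ⊆ B
    maximal J J⊆X indJ B⊆J {y} y∈J with y ∈? B
    ... | yes y∈B = y∈B
    ... | no y∉B = contradiction
      (≤-trans (rk-bound (p⊆q∧x∈q⇒p∪⁅x⁆⊆q B⊆X (J⊆X y∈J))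
                         (indep-sub M (p⊆q∧x∈q⇒p∪⁅x⁆⊆q B⊆J y∈J) indJ)) rk≤∣B∣)
      (<⇒≱ (x∉p⇒∣p∣<∣p∪⁅x⁆∣ B y∉B))

  rk-mono : ∀ {X Y} → X ⊆ Y → rk X ≤ rk Y
  rk-mono {X} X⊆Y = rk-bound (X⊆Y ∘ basis⊆ X) (basis-indep X)

  IsRank⇒rk≡ : ∀ {X k} → IsRank M X k → rk X ≡ k
  IsRank⇒rk≡ {X} ((I , I⊆X , indI , ∣I∣≡k) , bounded) =
    ≤-antisym (bounded _ (basis⊆ X) (basis-indep X)) (subst (_≤ rk X) ∣I∣≡k (rk-bound I⊆X indI))

  ∉-cl⇒rk< : ∀ {X Y e} → Y ⊆ X → e ∈ X → e ∉ Y → e ∉-cl Y → rk Y < rk X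
  ∉-cl⇒rk< {Y = Y} Y⊆X e∈X e∉Y e∉clY =
    <-≤-trans (x∉p⇒∣p∣<∣p∪⁅x⁆∣ (basis Y) (e∉Y ∘ basis⊆ Y))
              (rk-bound (p⊆q∧x∈q⇒p∪⁅x⁆⊆q (Y⊆X ∘ basis⊆ Y) e∈X)
                        (e∉clY (basis Y) (basis⊆ Y) (basis-indep Y)))

  basis-∪⁅⁆ : ∀ {Y B e} → IsBasis M Y B → ¬ Indep M (B ∪ ⁅ e ⁆) → IsBasis M (Y ∪ ⁅ e ⁆) B
  basis-∪⁅⁆ {Y} {B} {e} (B⊆Y , indB , maximal) dependent = p⊆p∪q ⁅ e ⁆ ∘ B⊆Y , indB , maximal′
    where
    maximal′ : ∀ J → J ⊆ Y ∪ ⁅ e ⁆ → Indep M J → B ⊆ J → J ⊆ B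
    maximal′ J J⊆Ye indJ B⊆J with e ∈? J
    ... | yes e∈J = ⊥-elim (dependent (indep-sub M (p⊆q∧x∈q⇒p∪⁅x⁆⊆q B⊆J e∈J) indJ))
    ... | no e∉J = maximal J J⊆Y indJ B⊆J
      where
      J⊆Y : J ⊆ Y
      J⊆Y {y} y∈J with y∈p∪⁅x⁆⇒y∈p⊎y≡x Y (J⊆Ye y∈J)
      ... | inj₁ y∈Y = y∈Y
      ... | inj₂ refl = contradiction y∈J e∉J

  -- If B ∪ {e} were dependent for a basis B of X ∖ C, then B would be a basis of
  -- (X ∖ C) ∪ {e}, so every basis of M|X missing C - e would have size at most ∣ B ∣;
  -- B would then be a basis of M|X missing C, which is impossible.
  cut⇒∉-cl : ∀ {X C e} → IsCut M X C → e ∈ C → e ∉-cl (X ─ C)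
  cut⇒∉-cl {X} {C} {e} (_ , C-meets , C-minimal) e∈C I I⊆X─C indI
    with extendToBasis (X ─ C) I I⊆X─C indI
  ... | B , I⊆B , B-basis@(B⊆X─C , indB , _) with Indep? M (B ∪ ⁅ e ⁆)
  ...   | yes indBe = indep-sub M (p⊆q∧x∈q⇒p∪⁅x⁆⊆q (p⊆p∪q ⁅ e ⁆ ∘ I⊆B) x∈p∪⁅x⁆) indBe
  ...   | no dependent =
    ⊥-elim (x∈p─q⇒x∉q (C-minimal (C - e) (p─q⊆p C ⁅ e ⁆) C-e-meets e∈C) (x∈⁅x⁆ e))
    where
    open ≤-Reasoning

    C-misses-B : ¬ Meets M C B
    C-misses-B (y , y∈C , y∈B) = x∈p─q⇒x∉q (B⊆X─C y∈B) y∈C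

    C-e-meets : MeetsAllBases M X (C - e)
    C-e-meets B′ B′-basis@(B′⊆X , indB′ , _)
      with any? (λ y → (y ∈? C - e) ×-dec (y ∈? B′))
    ... | yes meet = meet
    ... | no ¬meet = ⊥-elim (C-misses-B (C-meets B B-basis-of-X))
      where
      B′⊆Ye : B′ ⊆ (X ─ C) ∪ ⁅ e ⁆
      B′⊆Ye {y} y∈B′ with y ∈? C | y ≟ e
      ... | no y∉C | _ = p⊆p∪q ⁅ e ⁆ (x∈p∧x∉q⇒x∈p─q (B′⊆X y∈B′) y∉C)
      ... | yes _ | yes refl = x∈p∪⁅x⁆
      ... | yes y∈C | no y≢e = ⊥-elim (¬meet (y , x∈p∧x≢y⇒x∈p-y y∈C y≢e , y∈B′))

      B-basis-of-X : IsBasis M X B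
      B-basis-of-X = rk≤⇒basis (p─q⊆p X C ∘ B⊆X─C) indB (begin
        rk X   ≡⟨ sym (basis-size B′-basis) ⟩
        ∣ B′ ∣ ≤⟨ basis-maximum (basis-∪⁅⁆ B-basis dependent) B′⊆Ye indB′ ⟩
        ∣ B ∣  ∎)

  hyperplane-complement⇒cut : ∀ {X C} → C ⊆ X → rk X ≡ suc (rk (X ─ C)) →
    (∀ {e} → e ∈ C → e ∉-cl (X ─ C)) → IsCut M X C
  hyperplane-complement⇒cut {X} {C} C⊆X rk≡ C-∉-cl = C⊆X , meets , minimal
    where
    open ≤-Reasoning

    meets : MeetsAllBases M X C
    meets B B-basis@(B⊆X , indB , _) with any? (λ y → (y ∈? C) ×-dec (y ∈? B))
    ... | yes meet = meet
    ... | no ¬meet = contradiction (rk-bound B⊆X─C indB)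
                                   (<⇒≱ (≤-reflexive (sym (trans (basis-size B-basis) rk≡))))
      where
      B⊆X─C : B ⊆ X ─ C
      B⊆X─C y∈B = x∈p∧x∉q⇒x∈p─q (B⊆X y∈B) (λ y∈C → ¬meet (_ , y∈C , y∈B))

    minimal : ∀ D → D ⊆ C → MeetsAllBases M X D → C ⊆ D
    minimal D D⊆C D-meets {e} e∈C = meet⇒e∈D (D-meets (B₀ ∪ ⁅ e ⁆) B₀e-basis)
      where
      B₀ = basis (X ─ C)

      B₀e-basis : IsBasis M X (B₀ ∪ ⁅ e ⁆)
      B₀e-basis = rk≤⇒basis
        (p⊆q∧x∈q⇒p∪⁅x⁆⊆q (p─q⊆p X C ∘ basis⊆ (X ─ C)) (C⊆X e∈C))
        (C-∉-cl e∈C B₀ (basis⊆ (X ─ C)) (basis-indep (X ─ C)))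
        (begin
          rk X               ≡⟨ rk≡ ⟩
          suc ∣ B₀ ∣         ≤⟨ x∉p⇒∣p∣<∣p∪⁅x⁆∣ B₀ (λ e∈B₀ → x∈p─q⇒x∉q (basis⊆ (X ─ C) e∈B₀) e∈C) ⟩
          ∣ B₀ ∪ ⁅ e ⁆ ∣     ∎)

      meet⇒e∈D : Meets M D (B₀ ∪ ⁅ e ⁆) → e ∈ D
      meet⇒e∈D (y , y∈D , y∈B₀e) with y∈p∪⁅x⁆⇒y∈p⊎y≡x B₀ y∈B₀e
      ... | inj₁ y∈B₀ = ⊥-elim (x∈p─q⇒x∉q (basis⊆ (X ─ C) y∈B₀) (D⊆C y∈D))
      ... | inj₂ refl = y∈D

module Coloring {n m : ℕ} (col : Fin n → Fin m) where

  ∈Class⁺ : ∀ {X c x} → x ∈ X → col x ≡ c → x ∈ Class col X c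
  ∈Class⁺ {X} {c} = ∈tabulate-∧⁺ (_∈? X) (λ y → col y ≟ c)

  ∈Class⁻ : ∀ {X c x} → x ∈ Class col X c → x ∈ X × col x ≡ c
  ∈Class⁻ {X} {c} = ∈tabulate-∧⁻ (_∈? X) (λ y → col y ≟ c)

  Class-mono : ∀ {X Y c} → X ⊆ Y → Class col X c ⊆ Class col Y c
  Class-mono X⊆Y x∈ = let x∈X , eq = ∈Class⁻ x∈ in ∈Class⁺ (X⊆Y x∈X) eq

  module _ {X : Subset n} {k : ℕ} {σ : Fin k → Fin m} where

    ∈Prefix⁺ : ∀ {i j x} → x ∈ X → toℕ j ≤ toℕ i → σ j ≡ col x → x ∈ Prefix col X σ i
    ∈Prefix⁺ {i} {j} x∈X j≤i eq = ∈tabulate-∧⁺ (_∈? X)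
      (λ y → any? (λ j → (toℕ j ≤? toℕ i) ×-dec (σ j ≟ col y))) x∈X (j , j≤i , eq)

    ∈Prefix⁻ : ∀ {i x} → x ∈ Prefix col X σ i → x ∈ X × ∃ λ j → toℕ j ≤ toℕ i × σ j ≡ col x
    ∈Prefix⁻ {i} = ∈tabulate-∧⁻ (_∈? X)
      (λ y → any? (λ j → (toℕ j ≤? toℕ i) ×-dec (σ j ≟ col y)))

    Class⊆Prefix : ∀ {i} → Class col X (σ i) ⊆ Prefix col X σ i
    Class⊆Prefix x∈ = let x∈X , eq = ∈Class⁻ x∈ in ∈Prefix⁺ x∈X ≤-refl (sym eq)

  -- Prefix with a strict bound t : ℕ instead of an index, so that the ranks of the
  -- prefixes form a sequence indexed by ℕ.
  Below : Subset n → {k : ℕ} → (Fin k → Fin m) → ℕ → Subset n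
  Below X σ t = tabulate λ x → ⌊ x ∈? X ⌋ ∧ ⌊ any? (λ j → (toℕ j <? t) ×-dec (σ j ≟ col x)) ⌋

  module _ {X : Subset n} {k : ℕ} {σ : Fin k → Fin m} where

    ∈Below⁺ : ∀ {t j x} → x ∈ X → toℕ j < t → σ j ≡ col x → x ∈ Below X σ t
    ∈Below⁺ {t} {j} x∈X j<t eq = ∈tabulate-∧⁺ (_∈? X)
      (λ y → any? (λ j → (toℕ j <? t) ×-dec (σ j ≟ col y))) x∈X (j , j<t , eq)

    ∈Below⁻ : ∀ {t x} → x ∈ Below X σ t → x ∈ X × ∃ λ j → toℕ j < t × σ j ≡ col x
    ∈Below⁻ {t} = ∈tabulate-∧⁻ (_∈? X)
      (λ y → any? (λ j → (toℕ j <? t) ×-dec (σ j ≟ col y)))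

    Below⊆ : ∀ {t} → Below X σ t ⊆ X
    Below⊆ x∈ = proj₁ (∈Below⁻ x∈)

    Prefix⊆Below : ∀ {i} → Prefix col X σ i ⊆ Below X σ (suc (toℕ i))
    Prefix⊆Below x∈ = let x∈X , j , j≤i , eq = ∈Prefix⁻ x∈ in ∈Below⁺ x∈X (s≤s j≤i) eq

    Below⊆Prefix─Class : Injective _≡_ _≡_ σ →
      ∀ {i} → Below X σ (toℕ i) ⊆ Prefix col X σ i ─ Class col X (σ i)
    Below⊆Prefix─Class σ-injective x∈ with ∈Below⁻ x∈
    ... | x∈X , j , j<i , eq = x∈p∧x∉q⇒x∈p─q (∈Prefix⁺ x∈X (<⇒≤ j<i) eq)
      (λ x∈Class → <-irrefl (cong toℕ (σ-injective (trans eq (proj₂ (∈Class⁻ x∈Class))))) j<i)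

  module _ {X : Subset n} {k k′ : ℕ} {σ : Fin k → Fin m} {τ : Fin k′ → Fin m} where

    enumerations-embed : Enumerates col X k σ → Enumerates col X k′ τ →
      Σ (Fin k → Fin k′) (Injective _≡_ _≡_)
    enumerations-embed (σ-injective , σ-onto) (_ , τ-onto) = ρ , ρ-injective
      where
      τ-covers-σ : ∀ i → ∃ λ j → τ j ≡ σ i
      τ-covers-σ i = Equivalence.to (τ-onto (σ i)) (Equivalence.from (σ-onto (σ i)) (i , refl))

      ρ : Fin k → Fin k′
      ρ i = proj₁ (τ-covers-σ i)

      ρ-injective : Injective _≡_ _≡_ ρ
      ρ-injective {i} {j} eq = σ-injective
        (trans (sym (proj₂ (τ-covers-σ i))) (trans (cong τ eq) (proj₂ (τ-covers-σ j))))

  enumerations-size : ∀ {X k k′} {σ : Fin k → Fin m} {τ : Fin k′ → Fin m} →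
    Enumerates col X k σ → Enumerates col X k′ τ → k ≡ k′
  enumerations-size σ-enum τ-enum =
    ≤-antisym (injective⇒≤ (proj₂ (enumerations-embed σ-enum τ-enum)))
              (injective⇒≤ (proj₂ (enumerations-embed τ-enum σ-enum)))

module Restriction {n m k₀ : ℕ} (M : Matroid n) (col : Fin n → Fin m)
  {σ : Fin k₀ → Fin m} (σ-enum : Enumerates col ⊤ k₀ σ)
  (σ-cuts : ∀ q → IsCut M (Prefix col ⊤ σ q) (Class col ⊤ (σ q)))
  (Z : Subset n) where

  open MatroidTheory M
  open Coloring col
  -- σ′ = σ ∘ pick lists the colors appearing in Z, in the order given by σ.
  open IncreasingEnumeration
    (increasingEnumeration (λ q → any? (λ x → (x ∈? Z) ×-dec (col x ≟ σ q)))) public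

  σ′ : Fin size → Fin m
  σ′ = σ ∘ pick

  σ′-injective : Injective _≡_ _≡_ σ′
  σ′-injective = pick-injective ∘ proj₁ σ-enum

  σ′-enumerates : Enumerates col Z size σ′
  σ′-enumerates = σ′-injective , λ c →
    mk⇔ (covers c) (λ (i , σ′i≡c) → subst (Appears col Z) σ′i≡c (pick-sat i))
    where
    covers : ∀ c → Appears col Z c → ∃ λ i → σ′ i ≡ c
    covers c (x , x∈Z , col-x≡c) with Equivalence.to (proj₂ σ-enum c) (x , ∈⊤ , col-x≡c)
    ... | q , σq≡c with pick-onto (x , x∈Z , trans col-x≡c (sym σq≡c))
    ...   | i , refl = i , σq≡c

  S P : Fin size → Subset n
  S i = Class col Z (σ′ i)
  P i = Prefix col Z σ′ i

  P─S⊆ : ∀ i → P i ─ S i ⊆ Prefix col ⊤ σ (pick i) ─ Class col ⊤ (σ (pick i))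
  P─S⊆ i x∈ with ∈Prefix⁻ (p─q⊆p (P i) (S i) x∈)
  ... | x∈Z , j , j≤i , eq = x∈p∧x∉q⇒x∈p─q (∈Prefix⁺ ∈⊤ (pick-monotone j≤i) eq)
    (λ x∈Class → x∈p─q⇒x∉q x∈ (∈Class⁺ x∈Z (proj₂ (∈Class⁻ x∈Class))))

  S-∉-cl : ∀ i {e} → e ∈ S i → e ∉-cl (P i ─ S i)
  S-∉-cl i e∈S = ∉-cl-antitone (P─S⊆ i) (cut⇒∉-cl (σ-cuts (pick i)) (Class-mono (λ _ → ∈⊤) e∈S))

  rank-jump : ∀ i → rk (P i ─ S i) < rk (P i)
  rank-jump i = ∉-cl⇒rk< (p─q⊆p (P i) (S i)) (Class⊆Prefix e∈S) (λ e∈P─S → x∈p─q⇒x∉q e∈P─S e∈S)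
                         (S-∉-cl i e∈S)
    where
    e∈S : proj₁ (pick-sat i) ∈ S i
    e∈S = let _ , e∈Z , col-e≡ = pick-sat i in ∈Class⁺ e∈Z col-e≡

  rk-below : ℕ → ℕ
  rk-below t = rk (Below Z σ′ t)

  rk-below-increasing : ∀ t → t < size → suc (rk-below t) ≤ rk-below (suc t)
  rk-below-increasing t t<size = subst (λ s → suc (rk-below s) ≤ rk-below (suc s))
    (toℕ-fromℕ< t<size) (increasing-at (fromℕ< t<size))
    where
    open ≤-Reasoning
    increasing-at : ∀ i → suc (rk-below (toℕ i)) ≤ rk-below (suc (toℕ i))
    increasing-at i = begin-strict
      rk-below (toℕ i)        ≤⟨ rk-mono (Below⊆Prefix─Class σ′-injective) ⟩
      rk (P i ─ S i)          <⟨ rank-jump i ⟩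
      rk (P i)                ≤⟨ rk-mono Prefix⊆Below ⟩
      rk-below (suc (toℕ i))  ∎

  restricted-cuts : rk Z ≤ size → ∀ i → IsCut M (P i) (S i)
  restricted-cuts rkZ≤size i =
    hyperplane-complement⇒cut Class⊆Prefix (≤-antisym rk-P≤ (rank-jump i)) (S-∉-cl i)
    where
    open ≤-Reasoning
    unit-step : rk-below (suc (toℕ i)) ≤ suc (rk-below (toℕ i))
    unit-step = steps≤1 rk-below rk-below-increasing
                        (≤-trans (rk-mono Below⊆) rkZ≤size) (toℕ i) (toℕ<n i)

    rk-P≤ : rk (P i) ≤ suc (rk (P i ─ S i))
    rk-P≤ = begin
      rk (P i)                ≤⟨ rk-mono Prefix⊆Below ⟩
      rk-below (suc (toℕ i))  ≤⟨ unit-step ⟩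
      suc (rk-below (toℕ i))  ≤⟨ s≤s (rk-mono (Below⊆Prefix─Class σ′-injective)) ⟩
      suc (rk (P i ─ S i))    ∎

lemma14 : {n m : ℕ} (M : Matroid n) (col : Fin n → Fin m) →
    IsStandardColoring col M ⊤ →
    (Z : Subset n) (k : ℕ) → IsRank M Z k → NumColors col Z k →
    IsStandardColoring col M Z
lemma14 M col (_ , _ , σ , σ-enum , σ-cuts) Z k rkZ (_ , τ-enum) =
  size , subst (IsRank M Z) (sym size≡k) rkZ , σ′ , σ′-enumerates ,
  restricted-cuts (≤-reflexive (trans (IsRank⇒rk≡ rkZ) (sym size≡k)))
  where
  open MatroidTheory M using (IsRank⇒rk≡)
  open Restriction M col σ-enum σ-cuts Z
  size≡k : size ≡ k
  size≡k = Coloring.enumerations-size col σ′-enumerates τ-enum
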